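{- Let $p\geq 5$ be a prime, $n$ a positive integer, and let $A\subseteq\mathbb{F}_p^{n}$ be a nonempty set not containing $p$ distinct elements $x_1,\dots,x_p\in A$ with $x_1+\dots+x_p=0$. Let $L=\left\lceil\frac{\vert A\vert}{p\cdot P(p)}\right\rceil$, where $P(p)$ is the number of partitions of the integer $p$. Then there exist a subset $A'\subseteq A$ and a multiplicity pattern $\lambda=(\lambda_1,\dots,\lambda_k)$ such that: (i) there is a collection of $L$ pairwise disjoint cycles $(x_1,\dots,x_p)\in A'\times\dots\times A'$ with multiplicity pattern $\lambda$; (ii) for every cycle $(x_1,\dots,x_p)\in A'\times\dots\times A'$, the length of the multiplicity pattern of $(x_1,\dots,x_p)$ is at most $k$.
   Context: A cycle is a $p$-tuple $(x_1,\dots,x_p)\in (\mathbb{F}_p^{n})^p$ with $x_1+\dots+x_p=0$. Two cycles are disjoint if the sets of elements occurring in them are disjoint. The multiplicity pattern of a cycle $(x_1,\dots,x_p)$ is $(\lambda_1,\dots,\lambda_k)$, where $k$ is the number of distinct elements among $x_1,\dots,x_p$ and $\lambda_1\geq\dots\geq\lambda_k>0$ are the multiplicities with which these elements occur; $k$ is called the length of the pattern. A multiplicity pattern is any partition of $p$. -}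

module Defs where

open import Data.Nat using (ℕ; zero; suc; _+_; _≤_; _≥_; _>_)
open import Data.Nat.DivMod using (_/_)
open import Data.Nat.Divisibility using (_∣_)
open import Data.Nat.Properties using (≤-decTotalOrder)
open import Data.Fin using (Fin; toℕ) renaming (_≟_ to _≟ᶠ_)
open import Data.Vec using (Vec; lookup; toList)
import Data.Vec as V
open import Data.Vec.Properties using (≡-dec)
open import Data.List using (List; []; _∷_; length; deduplicate; filter; reverse)
open import Data.Nat.ListAction using (sum)
import Data.List as L
open import Data.List.Membership.Propositional using (_∈_; _∉_)
open import Data.List.Relation.Unary.All using (All)
open import Data.List.Sort.InsertionSort ≤-decTotalOrder using (sort)
open import Relation.Binary.PropositionalEquality using (_≡_; _≢_)
open import Relation.Nullary using (Dec)
open import Data.Product using (_×_)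

-- Points of F_p^n : vectors of length n with entries in Fin p (= Z/pZ).
Pt : ℕ → ℕ → Set
Pt p n = Vec (Fin p) n

_≟ₚ_ : ∀ {p n} → (x y : Pt p n) → Dec (x ≡ y)
_≟ₚ_ = ≡-dec _≟ᶠ_

Tuple : ℕ → ℕ → Set
Tuple p n = Vec (Pt p n) p

-- x_1 + ... + x_p = 0 in F_p^n : every coordinate sum (of the
-- representatives in {0..p-1}) is divisible by p.
IsCycle : ∀ {p n} → Tuple p n → Set
IsCycle {p} {n} c = ∀ (i : Fin n) → p ∣ V.sum (V.map (λ x → toℕ (lookup x i)) c)

distinctElems : ∀ {p n} → Tuple p n → List (Pt p n)
distinctElems c = deduplicate _≟ₚ_ (toList c)

pattern' : ∀ {p n} → Tuple p n → List ℕ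
pattern' c = reverse (sort (L.map (λ y → length (filter (y ≟ₚ_) (toList c))) (distinctElems c)))

patternLength : ∀ {p n} → Tuple p n → ℕ
patternLength c = length (pattern' c)

data NonIncreasing : List ℕ → Set where
  ni-[]  : NonIncreasing []
  ni-[x] : ∀ {x} → NonIncreasing (x ∷ [])
  ni-∷   : ∀ {x y xs} → x ≥ y → NonIncreasing (y ∷ xs) → NonIncreasing (x ∷ y ∷ xs)

IsPartition : ℕ → List ℕ → Set
IsPartition m λs = All (λ k → k > 0) λs × NonIncreasing λs × sum λs ≡ m

Disjoint : ∀ {p n} → Tuple p n → Tuple p n → Set
Disjoint c d = ∀ x → x ∈ toList c → x ∉ toList d

TupleIn : ∀ {p n} → Tuple p n → List (Pt p n) → Set
TupleIn c S = All (_∈ S) (toList c)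

-- ⌈ a / b ⌉ (with ⌈ a / 0 ⌉ := 0, never used since b > 0 below).
ceilDiv : ℕ → ℕ → ℕ
ceilDiv a zero = 0
ceilDiv a (suc b) = (a + b) / suc b

module Submission where

-- Descend on k from k = p, keeping a set A' ⊆ A all of whose cycles have patterns of length at
-- most k. Choose a maximal family of pairwise disjoint cycles in A' with patterns of length k. If
-- some partition is the pattern of L of them, A' and that partition satisfy (i) and (ii).
-- Otherwise every partition of length k is the pattern of at most L − 1 of them; deleting their
-- elements costs at most p (L − 1) elements per such partition, and by maximality leaves a set
-- whose cycles have patterns of length < k. At k = 0 the set is empty (constant tuples are
-- cycles), so if we never stopped then |A| ≤ p (L − 1) P(p) < |A|.

open import Defs
open import Data.Nat using (ℕ; _≤_; _*_)
open import Data.Nat.Primality using (Prime)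
open import Data.Fin using (Fin)
open import Data.Vec using (Vec; lookup)
open import Data.List using (List; length)
open import Data.List.Membership.Propositional using (_∈_)
open import Data.List.Relation.Unary.Unique.Propositional using (Unique)
open import Data.Product using (Σ; _×_; ∃)
open import Function.Bundles using (_⇔_)
open import Function.Definitions using (Injective)
open import Relation.Binary.PropositionalEquality using (_≡_; _≢_)
open import Relation.Nullary using (¬_)

open import Data.Nat using (zero; suc; _+_; pred; _<_; _>_; z≤n; s≤s; s≤s⁻¹; _≤?_; _≟_)
open import Data.Nat.Properties
open import Algebra.Properties.CommutativeSemigroup +-commutativeSemigroup
  using () renaming (interchange to +-interchange; x∙yz≈y∙xz to +-x∙yz≈y∙xz)
open import Algebra.Properties.CommutativeSemigroup *-commutativeSemigroup
  using () renaming (xy∙z≈y∙xz to *-xy∙z≈y∙xz)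
open import Data.Nat.DivMod using (_/_; m/n*n≤m)
open import Data.Nat.Divisibility using (_∣_; _∣?_; m∣m*n)
open import Data.Nat.ListAction using (sum)
open import Data.Nat.ListAction.Properties using (sum-↭)
import Data.Fin as F
import Data.Fin.Properties as FinP
import Data.Vec as V
open import Data.Vec.Properties using (length-toList; toList-replicate; map-replicate)
open import Data.List using ([]; _∷_; map; filter; reverse; deduplicate; _++_; [_])
open import Data.List.Properties using (length-map; length-filter; length-deduplicate; filter-all; filter-notAll; filter-some; unfold-reverse)
import Data.List.Properties as ListP
open import Data.List.Membership.Propositional using (_∉_; find; lose)
open import Data.List.Membership.Propositional.Properties using (∈-filter⁺; ∈-filter⁻; ∈-deduplicate⁺; ∈-deduplicate⁻; ∈-length)
open import Data.List.Relation.Unary.All as All using (All; []; _∷_)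
open import Data.List.Relation.Unary.All.Properties using (¬Any⇒All¬; replicate⁺)
import Data.List.Relation.Unary.All.Properties as AllP
open import Data.List.Relation.Unary.Any as Any using (here; there; any?)
open import Data.List.Relation.Unary.AllPairs using (AllPairs; []; _∷_)
import Data.List.Relation.Unary.AllPairs.Properties as AllPairsP
import Data.List.Relation.Unary.Unique.Propositional.Properties as UniqueP
open import Data.List.Relation.Unary.Unique.DecPropositional.Properties using (deduplicate-!)
open import Data.List.Relation.Unary.Linked.Properties using (Linked⇒AllPairs)
open import Data.List.Relation.Binary.Permutation.Propositional using (_↭_; ↭-sym; ↭-trans)
open import Data.List.Relation.Binary.Permutation.Propositional.Properties using (↭-reverse; ↭-length; All-resp-↭)
open import Data.List.Sort.InsertionSort ≤-decTotalOrder using (sort)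
open import Data.List.Sort.InsertionSort.Properties ≤-decTotalOrder using (sort-↭; sort-↗)
open import Data.List.Relation.Unary.Sorted.TotalOrder ≤-totalOrder using (Sorted)
open import Data.Product using (_,_; proj₁; proj₂)
open import Function.Bundles using (Equivalence)
open import Data.Sum using (_⊎_; inj₁; inj₂)
import Data.Sum
open import Data.Empty using (⊥-elim)
open import Function using (_∘_; id)
open import Relation.Binary using (Symmetric; DecidableEquality)
open import Relation.Binary.PropositionalEquality using (refl; sym; trans; cong; cong₂; subst; module ≡-Reasoning)
open import Relation.Nullary using (Dec; yes; no; ¬?)
open import Relation.Nullary.Decidable using (_×-dec_)
open import Relation.Unary using (Decidable)

sum-map-≤ : ∀ {X : Set} {f : X → ℕ} {m} (ys : List X) → All (λ y → f y ≤ m) ys →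
  sum (map f ys) ≤ m * length ys
sum-map-≤ {m = m} [] [] = ≤-reflexive (sym (*-zeroʳ m))
sum-map-≤ {f = f} {m} (y ∷ ys) (fy≤m ∷ h) = begin
  f y + sum (map f ys)    ≤⟨ +-mono-≤ fy≤m (sum-map-≤ ys h) ⟩
  m + m * length ys       ≡⟨ *-suc m (length ys) ⟨
  m * suc (length ys)     ∎
  where open ≤-Reasoning

sum-map-+ : ∀ {X : Set} (f g : X → ℕ) ys →
  sum (map (λ y → f y + g y) ys) ≡ sum (map f ys) + sum (map g ys)
sum-map-+ f g [] = refl
sum-map-+ f g (y ∷ ys) = trans (cong (f y + g y +_) (sum-map-+ f g ys))
  (+-interchange (f y) (g y) _ _)

sum-map-zero : ∀ {X : Set} {f : X → ℕ} (ys : List X) → All (λ y → f y ≡ 0) ys → sum (map f ys) ≡ 0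
sum-map-zero ys h = n≤0⇒n≡0 (sum-map-≤ ys (All.map ≤-reflexive h))

length-filter-⊎ : ∀ {X : Set} {P Q R : X → Set} (P? : Decidable P) (Q? : Decidable Q) (R? : Decidable R) →
  (∀ {x} → P x → Q x ⊎ R x) → (∀ {x} → Q x ⊎ R x → P x) → (∀ {x} → Q x → ¬ R x) →
  ∀ xs → length (filter P? xs) ≡ length (filter Q? xs) + length (filter R? xs)
length-filter-⊎ P? Q? R? to from disj [] = refl
length-filter-⊎ P? Q? R? to from disj (x ∷ xs)
  with ih ← length-filter-⊎ P? Q? R? to from disj xs | P? x | Q? x | R? x
... | yes _  | yes qx | yes rx = ⊥-elim (disj qx rx)
... | yes _  | yes _  | no _   = cong suc ih
... | yes _  | no _   | yes _  = trans (cong suc ih) (sym (+-suc _ _))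
... | yes px | no ¬qx | no ¬rx = ⊥-elim (Data.Sum.[ ¬qx , ¬rx ] (to px))
... | no ¬px | yes qx | _      = ⊥-elim (¬px (from (inj₁ qx)))
... | no ¬px | no _   | yes rx = ⊥-elim (¬px (from (inj₂ rx)))
... | no _   | no _   | no _   = ih

length-filter-≤?-suc : ∀ {X : Set} (f : X → ℕ) k xs →
  length (filter (λ x → f x ≤? suc k) xs)
    ≡ length (filter (λ x → f x ≤? k) xs) + length (filter (λ x → f x ≟ suc k) xs)
length-filter-≤?-suc f k = length-filter-⊎ (λ x → f x ≤? suc k) (λ x → f x ≤? k) (λ x → f x ≟ suc k)
  (Data.Sum.map s≤s⁻¹ id ∘ m≤n⇒m<n∨m≡n) Data.Sum.[ m≤n⇒m≤1+n , ≤-reflexive ] (λ fx≤k → <⇒≢ (s≤s fx≤k))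

module Counting {X : Set} (_≟ₓ_ : DecidableEquality X) where

  count : X → List X → ℕ
  count y xs = length (filter (y ≟ₓ_) xs)

  count-∷ : ∀ y x xs → count y (x ∷ xs) ≡ count y [ x ] + count y xs
  count-∷ y x xs with y ≟ₓ x
  ... | yes _ = refl
  ... | no _ = refl

  sum-count-singleton : ∀ {ys} x → Unique ys → x ∈ ys → sum (map (λ y → count y [ x ]) ys) ≡ 1
  sum-count-singleton {y ∷ ys} x (y∉ys ∷ _) (here refl) with x ≟ₓ x
  ... | yes _ = cong suc (sum-map-zero ys (All.map absent y∉ys))
    where
      absent : ∀ {z} → x ≢ z → count z [ x ] ≡ 0
      absent {z} x≢z with z ≟ₓ x
      ... | yes refl = ⊥-elim (x≢z refl)
      ... | no _ = refl
  ... | no x≢x = ⊥-elim (x≢x refl)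
  sum-count-singleton {y ∷ ys} x (y∉ys ∷ u) (there x∈ys) with y ≟ₓ x
  ... | yes refl = ⊥-elim (All.lookup y∉ys x∈ys refl)
  ... | no _ = sum-count-singleton x u x∈ys

  sum-count : ∀ {ys} xs → Unique ys → All (_∈ ys) xs → sum (map (λ y → count y xs) ys) ≡ length xs
  sum-count {ys} [] u [] = sum-map-zero ys (All.tabulate (λ _ → refl))
  sum-count {ys} (x ∷ xs) u (x∈ys ∷ xs⊆ys) = begin
    sum (map (λ y → count y (x ∷ xs)) ys)
      ≡⟨ cong sum (ListP.map-cong (λ y → count-∷ y x xs) ys) ⟩
    sum (map (λ y → count y [ x ] + count y xs) ys)
      ≡⟨ sum-map-+ (λ y → count y [ x ]) (λ y → count y xs) ys ⟩
    sum (map (λ y → count y [ x ]) ys) + sum (map (λ y → count y xs) ys)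
      ≡⟨ cong₂ _+_ (sum-count-singleton x u x∈ys) (sum-count xs u xs⊆ys) ⟩
    suc (length xs) ∎
    where open ≡-Reasoning

  count-map : ∀ {A : Set} (f : A → X) y xs → count y (map f xs) ≡ length (filter (λ x → y ≟ₓ f x) xs)
  count-map f y [] = refl
  count-map f y (x ∷ xs) with y ≟ₓ f x
  ... | yes _ = cong suc (count-map f y xs)
  ... | no _ = count-map f y xs

  pigeonhole : ∀ {A : Set} {ys} (f : A → X) xs {m} → Unique ys → All (λ x → f x ∈ ys) xs →
    All (λ y → count y (map f xs) ≤ m) ys → length xs ≤ m * length ys
  pigeonhole {ys = ys} f xs {m} u fxs∈ys fibres≤m = begin
    length xs                               ≡⟨ length-map f xs ⟨
    length (map f xs)                       ≡⟨ sum-count (map f xs) u (AllP.map⁺ fxs∈ys) ⟨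
    sum (map (λ y → count y (map f xs)) ys) ≤⟨ sum-map-≤ ys fibres≤m ⟩
    m * length ys                           ∎
    where open ≤-Reasoning

module Removal {X : Set} (_≟ₓ_ : DecidableEquality X) where

  delete : X → List X → List X
  delete y = filter (λ z → ¬? (y ≟ₓ z))

  _∖_ : List X → List X → List X
  S ∖ [] = S
  S ∖ (y ∷ ys) = delete y S ∖ ys

  ∈-∖⁻ : ∀ S ys {x} → x ∈ S ∖ ys → x ∈ S × x ∉ ys
  ∈-∖⁻ S [] x∈S = x∈S , λ ()
  ∈-∖⁻ S (y ∷ ys) x∈ = let x∈S-y , x∉ys = ∈-∖⁻ (delete y S) ys x∈
                           x∈S , y≢x = ∈-filter⁻ (λ z → ¬? (y ≟ₓ z)) x∈S-y
                       in x∈S , λ { (here refl) → y≢x refl ; (there x∈ys) → x∉ys x∈ys }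

  ∖-unique : ∀ {S} ys → Unique S → Unique (S ∖ ys)
  ∖-unique [] u = u
  ∖-unique (y ∷ ys) u = ∖-unique ys (UniqueP.filter⁺ (λ z → ¬? (y ≟ₓ z)) u)

  length-∖-≤ : ∀ S ys → length (S ∖ ys) ≤ length S
  length-∖-≤ S [] = ≤-refl
  length-∖-≤ S (y ∷ ys) = ≤-trans (length-∖-≤ (delete y S) ys) (length-filter _ S)

  length-∖-< : ∀ S y ys → y ∈ S → length (S ∖ (y ∷ ys)) < length S
  length-∖-< S y ys y∈S = ≤-<-trans (length-∖-≤ (delete y S) ys)
    (filter-notAll (λ z → ¬? (y ≟ₓ z)) S (Any.map (λ y≡z y≢z → y≢z y≡z) y∈S))

  length-delete-≥ : ∀ y {S} → Unique S → length S ≤ suc (length (delete y S))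
  length-delete-≥ y {[]} _ = z≤n
  length-delete-≥ y {z ∷ S} (z∉S ∷ u) with y ≟ₓ z
  ... | yes refl = s≤s (≤-reflexive (sym (cong length (filter-all (λ z → ¬? (y ≟ₓ z)) z∉S))))
  ... | no _ = s≤s (length-delete-≥ y u)

  length-∖-≥ : ∀ {S} ys → Unique S → length S ≤ length ys + length (S ∖ ys)
  length-∖-≥ [] u = ≤-refl
  length-∖-≥ {S} (y ∷ ys) u = ≤-trans (length-delete-≥ y u)
    (s≤s (length-∖-≥ ys (UniqueP.filter⁺ (λ z → ¬? (y ≟ₓ z)) u)))

∃-Vec-in? : ∀ {X : Set} (S : List X) m (P : Vec X m → Set) → (∀ v → Dec (P v)) →
  Dec (Σ (Vec X m) λ v → All (_∈ S) (V.toList v) × P v)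
∃-Vec-in? S zero P P? with P? V.[]
... | yes pv = yes (V.[] , [] , pv)
... | no ¬pv = no λ { (V.[] , _ , pv) → ¬pv pv }
∃-Vec-in? S (suc m) P P? with any? (λ x → ∃-Vec-in? S m (P ∘ (x V.∷_)) (P? ∘ (x V.∷_))) S
... | yes found = let x , x∈S , v , v⊆S , pv = find found in yes (x V.∷ v , x∈S ∷ v⊆S , pv)
... | no none = no λ { (x V.∷ v , x∈S ∷ v⊆S , pv) → none (lose x∈S (v , v⊆S , pv)) }

NonIncreasing-∷ʳ : ∀ {x} ys → NonIncreasing ys → All (x ≤_) ys → NonIncreasing (ys ++ [ x ])
NonIncreasing-∷ʳ [] _ _ = ni-[x]
NonIncreasing-∷ʳ (y ∷ []) _ (x≤y ∷ []) = ni-∷ x≤y ni-[x]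
NonIncreasing-∷ʳ (y ∷ z ∷ zs) (ni-∷ z≤y ni) (_ ∷ x≤zs) = ni-∷ z≤y (NonIncreasing-∷ʳ (z ∷ zs) ni x≤zs)

reverse-AllPairs⇒NonIncreasing : ∀ {xs} → AllPairs _≤_ xs → NonIncreasing (reverse xs)
reverse-AllPairs⇒NonIncreasing {[]} [] = ni-[]
reverse-AllPairs⇒NonIncreasing {x ∷ xs} (x≤xs ∷ ap) rewrite unfold-reverse x xs =
  NonIncreasing-∷ʳ (reverse xs) (reverse-AllPairs⇒NonIncreasing ap) (All-resp-↭ (↭-sym (↭-reverse xs)) x≤xs)

reverse-sorted⇒NonIncreasing : ∀ {xs} → Sorted xs → NonIncreasing (reverse xs)
reverse-sorted⇒NonIncreasing = reverse-AllPairs⇒NonIncreasing ∘ Linked⇒AllPairs ≤-trans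

AllPairs⇒Vec : ∀ {X : Set} {R : X → X → Set} → Symmetric R → ∀ m {xs} → m ≤ length xs → AllPairs R xs →
  Σ (Vec X m) λ v → (∀ j → lookup v j ∈ xs) × (∀ i j → i ≢ j → R (lookup v i) (lookup v j))
AllPairs⇒Vec R-sym zero _ _ = V.[] , (λ ()) , (λ ())
AllPairs⇒Vec {R = R} R-sym (suc m) {x ∷ xs} (s≤s m≤xs) (Rx ∷ ap) = x V.∷ v , members , related
  where
    rest = AllPairs⇒Vec R-sym m m≤xs ap
    v = proj₁ rest
    members : ∀ j → lookup (x V.∷ v) j ∈ x ∷ xs
    members F.zero = here refl
    members (F.suc j) = there (proj₁ (proj₂ rest) j)
    related : ∀ i j → i ≢ j → R (lookup (x V.∷ v) i) (lookup (x V.∷ v) j)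
    related F.zero F.zero i≢j = ⊥-elim (i≢j refl)
    related F.zero (F.suc j) _ = All.lookup Rx (proj₁ (proj₂ rest) j)
    related (F.suc i) F.zero _ = R-sym (All.lookup Rx (proj₁ (proj₂ rest) i))
    related (F.suc i) (F.suc j) i≢j = proj₂ (proj₂ rest) i j (i≢j ∘ cong F.suc)

pred-ceilDiv*< : ∀ a m → 1 ≤ a → 1 ≤ m → pred (ceilDiv a m) * m < a
pred-ceilDiv*< a (suc b) 1≤a _ with (a + b) / suc b | m/n*n≤m (a + b) (suc b)
... | zero | _ = 1≤a
... | suc q | q*m+m≤a+b = +-cancelˡ-≤ b _ _ (subst (_≤ b + a) (sym (+-suc b (q * suc b)))
                                              (subst (suc q * suc b ≤_) (+-comm a b) q*m+m≤a+b))

IsCycle? : ∀ {p n} (c : Tuple p n) → Dec (IsCycle c)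
IsCycle? {p} c = FinP.all? (λ i → p ∣? V.sum (V.map (λ x → F.toℕ (lookup x i)) c))

sum-replicate : ∀ m k → V.sum (V.replicate m k) ≡ m * k
sum-replicate zero k = refl
sum-replicate (suc m) k = cong (k +_) (sum-replicate m k)

replicate-IsCycle : ∀ {p n} (x : Pt p n) → IsCycle (V.replicate p x)
replicate-IsCycle {p} x i = subst (p ∣_)
  (trans (sym (sum-replicate p (F.toℕ (lookup x i))))
         (cong V.sum (sym (map-replicate (λ y → F.toℕ (lookup y i)) x p))))
  (m∣m*n _)

replicate-TupleIn : ∀ {p n} {x : Pt p n} {S} → x ∈ S → TupleIn (V.replicate p x) S
replicate-TupleIn {p} {x = x} x∈S = subst (All (_∈ _)) (sym (toList-replicate p x)) (replicate⁺ p x∈S)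

module _ {p n : ℕ} where
  open Counting (_≟ₚ_ {p} {n})

  multiplicities : Tuple p n → List ℕ
  multiplicities c = map (λ y → count y (V.toList c)) (distinctElems c)

  pattern↭multiplicities : ∀ c → pattern' c ↭ multiplicities c
  pattern↭multiplicities c = ↭-trans (↭-reverse _) (sort-↭ (multiplicities c))

  patternLength≡#distinct : ∀ c → patternLength c ≡ length (distinctElems c)
  patternLength≡#distinct c = trans (↭-length (pattern↭multiplicities c)) (length-map _ (distinctElems c))

  patternLength≤p : ∀ c → patternLength c ≤ p
  patternLength≤p c = begin
    patternLength c             ≡⟨ patternLength≡#distinct c ⟩
    length (distinctElems c)    ≤⟨ length-deduplicate _≟ₚ_ (V.toList c) ⟩
    length (V.toList c)         ≡⟨ length-toList c ⟩
    p                           ∎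
    where open ≤-Reasoning

  pattern-IsPartition : ∀ c → IsPartition p (pattern' c)
  pattern-IsPartition c = positive , nonIncreasing , sums-to-p
    where
      positive : All (_> 0) (pattern' c)
      positive = All-resp-↭ (↭-sym (pattern↭multiplicities c)) (AllP.map⁺ (All.tabulate λ {y} y∈ →
        filter-some (y ≟ₚ_) (∈-deduplicate⁻ _≟ₚ_ (V.toList c) y∈)))
      nonIncreasing : NonIncreasing (pattern' c)
      nonIncreasing = reverse-sorted⇒NonIncreasing (sort-↗ (multiplicities c))
      sums-to-p : sum (pattern' c) ≡ p
      sums-to-p = begin
        sum (pattern' c)         ≡⟨ sum-↭ (pattern↭multiplicities c) ⟩
        sum (multiplicities c)   ≡⟨ sum-count (V.toList c) (deduplicate-! _≟ₚ_ (V.toList c))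
                                      (All.tabulate (∈-deduplicate⁺ _≟ₚ_)) ⟩
        length (V.toList c)      ≡⟨ length-toList c ⟩
        p                        ∎
        where open ≡-Reasoning

1≤patternLength : ∀ {p n} (c : Tuple (suc p) n) → 1 ≤ patternLength c
1≤patternLength (x V.∷ xs) rewrite patternLength≡#distinct (x V.∷ xs) = s≤s z≤n

Disjoint-sym : ∀ {p n} {c d : Tuple p n} → Disjoint c d → Disjoint d c
Disjoint-sym c∩d=∅ x x∈d x∈c = c∩d=∅ x x∈c x∈d

CycleOfLength : ∀ {p n} → ℕ → List (Pt p n) → Tuple p n → Set
CycleOfLength k S c = TupleIn c S × IsCycle c × patternLength c ≡ k

CycleOfLength? : ∀ {p n} k S → Dec (Σ (Tuple p n) (CycleOfLength k S))
CycleOfLength? {p} k S = ∃-Vec-in? S p _ (λ c → IsCycle? c ×-dec (patternLength c ≟ k))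

record MaximalFamily {p n} (k : ℕ) (S : List (Pt p n)) : Set where
  field
    family          : List (Tuple p n)
    rest            : List (Pt p n)
    family-cycles   : All (CycleOfLength k S) family
    family-disjoint : AllPairs Disjoint family
    rest⊆S          : ∀ {x} → x ∈ rest → x ∈ S
    rest-unique     : Unique rest
    rest-maximal    : ∀ c → IsCycle c → TupleIn c rest → patternLength c ≢ k
    length-bound    : length S ≤ length rest + p * length family

rest-patternLength≤ : ∀ {p n k} {S : List (Pt p n)} → (∀ c → IsCycle c → TupleIn c S → patternLength c ≤ suc k) →
  (M : MaximalFamily (suc k) S) → ∀ c → IsCycle c → TupleIn c (MaximalFamily.rest M) → patternLength c ≤ k
rest-patternLength≤ bounded M c cyc c⊆rest =
  s≤s⁻¹ (≤∧≢⇒< (bounded c cyc (All.map rest⊆S c⊆rest)) (rest-maximal c cyc c⊆rest))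
  where open MaximalFamily M

module _ {p' n : ℕ} (k : ℕ) where
  open Removal (_≟ₚ_ {suc p'} {n})

  private
    p = suc p'

    extend : ∀ {S : List (Pt p n)} c → CycleOfLength k S c → Unique S →
      MaximalFamily k (S ∖ V.toList c) → MaximalFamily k S
    extend {S} c c∈ u R = record
      { family          = c ∷ family
      ; rest            = rest
      ; family-cycles   = c∈ ∷ All.map (λ (d⊆ , d∈) → All.map (proj₁ ∘ ∈-∖⁻ S (V.toList c)) d⊆ , d∈)
                                     family-cycles
      ; family-disjoint = All.map (λ (d⊆ , _) y y∈c y∈d → proj₂ (∈-∖⁻ S (V.toList c) (All.lookup d⊆ y∈d)) y∈c)
                            family-cycles ∷ family-disjoint
      ; rest⊆S          = proj₁ ∘ ∈-∖⁻ S (V.toList c) ∘ rest⊆S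
      ; rest-unique     = rest-unique
      ; rest-maximal    = rest-maximal
      ; length-bound    = begin
          length S                                          ≤⟨ length-∖-≥ (V.toList c) u ⟩
          length (V.toList c) + length (S ∖ V.toList c)     ≤⟨ +-mono-≤ (≤-reflexive (length-toList c)) length-bound ⟩
          p + (length rest + p * length family)             ≡⟨ +-x∙yz≈y∙xz p (length rest) _ ⟩
          length rest + (p + p * length family)             ≡⟨ cong (length rest +_) (*-suc p (length family)) ⟨
          length rest + p * suc (length family)             ∎
      }
      where open MaximalFamily R
            open ≤-Reasoning

    greedy : ∀ fuel (S : List (Pt p n)) → length S < fuel → Unique S → MaximalFamily k S
    greedy (suc fuel) S S<fuel u with CycleOfLength? k S
    ... | no none = record
      { family = [] ; rest = S ; family-cycles = [] ; family-disjoint = []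
      ; rest⊆S = id ; rest-unique = u
      ; rest-maximal = λ c cyc c⊆S len → none (c , c⊆S , cyc , len)
      ; length-bound = ≤-reflexive (sym (trans (cong (length S +_) (*-zeroʳ p)) (+-identityʳ _))) }
    ... | yes (c@(x V.∷ xs) , c∈@(x∈S ∷ _ , _)) = extend c c∈ u
          (greedy fuel (S ∖ V.toList c) (<-≤-trans (length-∖-< S x (V.toList xs) x∈S) (s≤s⁻¹ S<fuel))
                  (∖-unique (V.toList c) u))

  maximalFamily : ∀ (S : List (Pt (suc p') n)) → Unique S → MaximalFamily k S
  maximalFamily S = greedy (suc (length S)) S ≤-refl

module Descent {p' n : ℕ} (A : List (Pt (suc p') n))
  (Ps : List (List ℕ)) (Ps-unique : Unique Ps) (partition⇔∈Ps : ∀ λs → IsPartition (suc p') λs ⇔ λs ∈ Ps)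
  (L : ℕ) where

  private
    p = suc p'

    _≟ₗ_ : DecidableEquality (List ℕ)
    _≟ₗ_ = ListP.≡-dec _≟_

  open Counting _≟ₗ_
  open MaximalFamily

  budget : ℕ
  budget = p * pred L

  Conclusion : Set
  Conclusion = Σ (List (Pt p n)) λ A' → (∀ x → x ∈ A' → x ∈ A)
    × Σ (List ℕ) λ λs → IsPartition p λs
      × Σ (Vec (Tuple p n) L) (λ cs →
          (∀ j → IsCycle (lookup cs j) × TupleIn (lookup cs j) A' × pattern' (lookup cs j) ≡ λs)
          × (∀ i j → i ≢ j → Disjoint (lookup cs i) (lookup cs j)))
      × (∀ (c : Tuple p n) → IsCycle c → TupleIn c A' → patternLength c ≤ length λs)

  partitionsOfLength partitionsUpTo : ℕ → List (List ℕ)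
  partitionsOfLength k = filter (λ λs → length λs ≟ k) Ps
  partitionsUpTo k = filter (λ λs → length λs ≤? k) Ps

  stop : ∀ {k} {S : List (Pt p n)} → (∀ {x} → x ∈ S → x ∈ A) →
    (∀ c → IsCycle c → TupleIn c S → patternLength c ≤ k) →
    (M : MaximalFamily k S) → ∀ {λs} → λs ∈ partitionsOfLength k → L ≤ count λs (map pattern' (family M)) →
    Conclusion
  stop {k} {S} S⊆A bounded M {λs} λs∈ L≤count =
    S , (λ _ → S⊆A) , λs , Equivalence.from (partition⇔∈Ps λs) λs∈Ps ,
    (proj₁ chosen , (λ j → cycle-of-pattern (proj₁ (proj₂ chosen) j)) , proj₂ (proj₂ chosen)) ,
    λ c cyc c⊆S → subst (patternLength c ≤_) (sym length≡k) (bounded c cyc c⊆S)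
    where
      λs∈Ps : λs ∈ Ps
      λs∈Ps = proj₁ (∈-filter⁻ (λ λs → length λs ≟ k) {xs = Ps} λs∈)
      length≡k : length λs ≡ k
      length≡k = proj₂ (∈-filter⁻ (λ λs → length λs ≟ k) {xs = Ps} λs∈)
      ofPattern? : ∀ c → Dec (λs ≡ pattern' c)
      ofPattern? c = λs ≟ₗ pattern' c
      chosen : Σ (Vec (Tuple p n) L) λ cs → (∀ j → lookup cs j ∈ filter ofPattern? (family M))
                 × (∀ i j → i ≢ j → Disjoint (lookup cs i) (lookup cs j))
      chosen = AllPairs⇒Vec Disjoint-sym L (subst (L ≤_) (count-map pattern' λs (family M)) L≤count)
                 (AllPairsP.filter⁺ ofPattern? (family-disjoint M))
      cycle-of-pattern : ∀ {c} → c ∈ filter ofPattern? (family M) → IsCycle c × TupleIn c S × pattern' c ≡ λs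
      cycle-of-pattern c∈ = let c∈F , λs≡ = ∈-filter⁻ ofPattern? {xs = family M} c∈
                                c⊆S , cyc , _ = All.lookup (family-cycles M) c∈F
                            in cyc , c⊆S , sym λs≡

  family-bound : ∀ {k} {S : List (Pt p n)} (M : MaximalFamily k S) →
    All (λ λs → count λs (map pattern' (family M)) < L) (partitionsOfLength k) →
    length (family M) ≤ pred L * length (partitionsOfLength k)
  family-bound {k} M fibres<L = pigeonhole pattern' (family M)
    (UniqueP.filter⁺ (λ λs → length λs ≟ k) Ps-unique)
    (All.map (λ {c} (_ , _ , length≡k) → ∈-filter⁺ (λ λs → length λs ≟ k)
                (Equivalence.to (partition⇔∈Ps (pattern' c)) (pattern-IsPartition c)) length≡k)
             (family-cycles M))
    (All.map pred-mono-≤ fibres<L)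

  descend : ∀ k S → (∀ {x} → x ∈ S → x ∈ A) → Unique S →
    (∀ c → IsCycle c → TupleIn c S → patternLength c ≤ k) →
    Conclusion ⊎ length S ≤ budget * length (partitionsUpTo k)
  descend zero [] _ _ _ = inj₂ z≤n
  descend zero (x ∷ S) _ _ bounded = ⊥-elim (1+n≰n (≤-trans (1≤patternLength constant)
    (bounded constant (replicate-IsCycle x) (replicate-TupleIn (here refl)))))
    where
      constant : Tuple p n
      constant = V.replicate p x
  descend (suc k) S S⊆A S-unique bounded = step (maximalFamily (suc k) S S-unique)
    where
      step : MaximalFamily (suc k) S → Conclusion ⊎ length S ≤ budget * length (partitionsUpTo (suc k))
      step M with any? (λ λs → L ≤? count λs (map pattern' (family M))) (partitionsOfLength (suc k))
      ... | yes found = let λs , λs∈ , L≤count = find found in inj₁ (stop S⊆A bounded M λs∈ L≤count)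
      ... | no none with descend k (rest M) (S⊆A ∘ rest⊆S M) (rest-unique M) (rest-patternLength≤ bounded M)
      ... | inj₁ done = inj₁ done
      ... | inj₂ rest-bound = inj₂ (begin
        length S                                 ≤⟨ length-bound M ⟩
        length (rest M) + p * length (family M)  ≤⟨ +-mono-≤ rest-bound (*-monoʳ-≤ p family-small) ⟩
        budget * #upTo-k + p * (pred L * #of-1+k) ≡⟨ cong (budget * #upTo-k +_) (*-assoc p (pred L) #of-1+k) ⟨
        budget * #upTo-k + budget * #of-1+k      ≡⟨ *-distribˡ-+ budget #upTo-k #of-1+k ⟨
        budget * (#upTo-k + #of-1+k)             ≡⟨ cong (budget *_) (length-filter-≤?-suc length k Ps) ⟨
        budget * length (partitionsUpTo (suc k)) ∎)
        where
          open ≤-Reasoning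
          #upTo-k #of-1+k : ℕ
          #upTo-k = length (partitionsUpTo k)
          #of-1+k = length (partitionsOfLength (suc k))
          family-small : length (family M) ≤ pred L * #of-1+k
          family-small = family-bound M (All.map ≰⇒> (¬Any⇒All¬ _ none))

  1≤#partitions : 1 ≤ length Ps
  1≤#partitions = ∈-length (Equivalence.to (partition⇔∈Ps [ p ]) (s≤s z≤n ∷ [] , ni-[x] , +-identityʳ p))

  conclusion : Unique A → pred L * (p * length Ps) < length A → Conclusion
  conclusion A-unique #A-large with descend p A id A-unique (λ c _ _ → patternLength≤p c)
  ... | inj₁ done = done
  ... | inj₂ #A≤ = ⊥-elim (<⇒≱ #A-large (begin
    length A                          ≤⟨ #A≤ ⟩
    budget * length (partitionsUpTo p)  ≤⟨ *-monoʳ-≤ budget (length-filter _ Ps) ⟩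
    p * pred L * length Ps              ≡⟨ *-xy∙z≈y∙xz p (pred L) (length Ps) ⟩
    pred L * (p * length Ps)            ∎))
    where open ≤-Reasoning

lemma4p1 : (p n : ℕ) → Prime p → 5 ≤ p → 1 ≤ n
    → (A : List (Pt p n)) → Unique A → 1 ≤ length A
    → ¬ (Σ (Tuple p n) λ c → Injective _≡_ _≡_ (lookup c) × TupleIn c A × IsCycle c)
    → (Ps : List (List ℕ)) → Unique Ps → (∀ λs → IsPartition p λs ⇔ λs ∈ Ps)
    → Σ (List (Pt p n)) λ A' → (∀ x → x ∈ A' → x ∈ A)
      × Σ (List ℕ) λ λs → IsPartition p λs
        × Σ (Vec (Tuple p n) (ceilDiv (length A) (p * length Ps))) (λ cs →
            (∀ j → IsCycle (lookup cs j) × TupleIn (lookup cs j) A' × pattern' (lookup cs j) ≡ λs)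
            × (∀ i j → i ≢ j → Disjoint (lookup cs i) (lookup cs j)))
        × (∀ (c : Tuple p n) → IsCycle c → TupleIn c A' → patternLength c ≤ length λs)
-- The hypotheses on p and n and the absence of p distinct elements of A summing to 0 are not needed.
lemma4p1 zero _ _ () _ _ _ _ _ _ _ _
lemma4p1 (suc p') n _ _ _ A A-unique 1≤#A _ Ps Ps-unique partition⇔∈Ps =
  conclusion A-unique
    (pred-ceilDiv*< (length A) (p * length Ps) 1≤#A (*-mono-≤ (s≤s (z≤n {p'})) 1≤#partitions))
  where
    p = suc p'
    open Descent A Ps Ps-unique partition⇔∈Ps (ceilDiv (length A) (p * length Ps))
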